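{- Fix integers $k,r\ge 1$ and $n\ge 0$. Let $\lambda=(n+1)^2$ be the two-row shape with both rows of length $n+1$, and let $\rho(k,r)$ be the density with $\rho_{1,j}=1$ for all $1\le j\le n+1$, $\rho_{2,1}=r-1$, and $\rho_{2,j}=k-1$ for all $2\le j\le n+1$. Then the Raney number $R_{k,r}(n)=\frac{r}{kn+r}\binom{kn+r}{n}$ equals $\lvert \mathrm{SVT}((n+1)^2,\rho(k,r))\rvert$.
   Context: Cell $(i,j)$ is in row $i$, column $j$. A density $\rho$ assigns a nonnegative integer $\rho_{i,j}$ to each cell; with $N=\sum\rho_{i,j}$, a standard set-valued Young tableau of shape $\lambda$ and density $\rho$ is an assignment to each cell $(i,j)$ of a set of exactly $\rho_{i,j}$ integers (possibly empty), these sets partitioning $\{1,\dots,N\}$, such that every integer in cell $(i,j)$ is smaller than every integer in cells $(i,j+1)$ and $(i+1,j)$ when these exist. $\mathrm{SVT}(\lambda,\rho)$ is the set of such tableaux. -}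

module Defs where

open import Data.Nat using (ℕ; zero; suc; _+_; _*_; _∸_; _≤_; _>_; NonZero; >-nonZero)
open import Data.Nat.Properties using (m≤n+m; ≤-trans)
open import Data.Nat.DivMod using (_/_)
open import Data.Nat.Combinatorics using (_C_)
open import Data.List using (List; []; _∷_; map; length; upTo)
open import Data.Nat.ListAction using (sum)
open import Data.Maybe using (Maybe; just; nothing)
open import Data.Fin using (Fin) renaming (_<_ to _<ᶠ_)
open import Data.Fin.Subset using (Subset; _∈_; ∣_∣)
open import Data.Product using (Σ; ∃; _×_)
open import Relation.Binary.PropositionalEquality using (_≡_)
open import Function.Definitions using (Injective)

-- Conventions: rows and columns are 0-indexed (paper cell (i,j) is our (i-1,j-1)).
-- A shape is the list of row lengths; a density is a function ℕ → ℕ → ℕ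
-- (row, column) ↦ ρ, only its values on cells of the shape matter.
-- The integers {1,…,N} are represented by Fin N (order-preserving shift by 1).

Shape : Set
Shape = List ℕ

Density : Set
Density = ℕ → ℕ → ℕ

rowSum : Density → ℕ → ℕ → ℕ
rowSum ρ i len = sum (map (ρ i) (upTo len))

totalFrom : Density → ℕ → Shape → ℕ
totalFrom ρ i [] = 0
totalFrom ρ i (len ∷ λ′) = rowSum ρ i len + totalFrom ρ (suc i) λ′

total : Shape → Density → ℕ
total λ′ ρ = totalFrom ρ 0 λ′

Filling : ℕ → Set
Filling N = List (List (Subset N))

lookupL : {A : Set} → List A → ℕ → Maybe A
lookupL [] _ = nothing
lookupL (x ∷ xs) zero = just x
lookupL (x ∷ xs) (suc i) = lookupL xs i

entry : {N : ℕ} → Filling N → ℕ → ℕ → Maybe (Subset N)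
entry [] i j = nothing
entry (row ∷ rows) zero j = lookupL row j
entry (row ∷ rows) (suc i) j = entry rows i j

In : {N : ℕ} → Filling N → Fin N → ℕ → ℕ → Set
In T x i j = Σ _ λ S → entry T i j ≡ just S × x ∈ S

record IsSVT (λ′ : Shape) (ρ : Density) (T : Filling (total λ′ ρ)) : Set where
  field
    shape     : map length T ≡ λ′
    density   : ∀ i j S → entry T i j ≡ just S → ∣ S ∣ ≡ ρ i j
    covering  : ∀ x → ∃ λ i → ∃ λ j → In T x i j
    disjoint  : ∀ x i j i′ j′ → In T x i j → In T x i′ j′ → (i ≡ i′ × j ≡ j′)
    rowIncr   : ∀ x y i j → In T x i j → In T y i (suc j) → x <ᶠ y
    colIncr   : ∀ x y i j → In T x i j → In T y (suc i) j → x <ᶠ y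

HasCard : {A : Set} → (A → Set) → ℕ → Set
HasCard {A} P m =
  Σ (Fin m → A) λ f →
    (∀ i → P (f i)) × Injective _≡_ _≡_ f × (∀ a → P a → ∃ λ i → f i ≡ a)

CardSVT : Shape → Density → ℕ → Set
CardSVT λ′ ρ m = HasCard (IsSVT λ′ ρ) m

-- Raney number R_{k,r}(n) = r/(kn+r) * binom(kn+r, n)  (exact division)
raney : (k r n : ℕ) → 1 ≤ r → ℕ
raney k r n hr =
  _/_ (r * ((k * n + r) C n)) (k * n + r) {{>-nonZero (≤-trans hr (m≤n+m r (k * n)))}}

square2 : ℕ → Shape
square2 n = suc n ∷ suc n ∷ []

ρkr : ℕ → ℕ → Density
ρkr k r zero j = 1
ρkr k r (suc zero) zero = r ∸ 1
ρkr k r (suc zero) (suc j) = k ∸ 1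
ρkr k r (suc (suc i)) j = 0

module Submission where

-- A function ballot t h, given by the two-term
--    recursion "read a free bottom integer, or read the next top cell, which
--    frees k − 1 more", satisfies ballot t h · (kt+h+1) = (h+1) · C(kt+h+1, t),
--    by Pascal's rule and absorption; so R_{k,r}(n) = ballot n (r − 1).
-- 2. Words (module TwoRow).  A tableau is determined by its word, the list whose
--    x-th letter is the cell containing x; the words of tableaux are exactly the
--    lists of cells with the prescribed multiplicities that never list a cell
--    after one it must precede.
-- 3. Completions (modules Completions, Enumeration).  Such words are read
--    through states (p, q): top cells left of column p read, q the sorted queue
--    of bottom integers left.  The words reachable from the start state are
--    enumerated bijectively by Fin (ballot n (r − 1)) (module Count).

open import Defs
open import Data.Nat using (ℕ; NonZero; >-nonZero; zero; suc; _+_; _*_; _≤_; _<_; z≤n; s≤s; s≤s⁻¹)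
open import Data.Nat.Properties
  using ( +-comm; +-suc; +-identityʳ; +-cancelʳ-≡; *-comm; *-assoc; *-suc; *-zeroʳ; *-identityˡ; *-identityʳ
        ; *-cancelˡ-≡; *-distribˡ-+; suc-injective; 0≢1+n; 1+n≢0; _≤?_; _<?_; ≤-refl; ≤-reflexive; ≤-trans
        ; ≤-antisym; <-cmp; <-asym; <-irrefl; <⇒≤; ≰⇒>; ≮⇒≥; ≤∧≢⇒<; <-≤-trans; ≤-<-trans; n≤0⇒n≡0; n≮0
        ; m≤m+n; m≤n+m; m≤n⇒m≤1+n; m<n⇒m<1+n; n<1+n; n≤1+n )
open import Data.Nat.Instances
open import Data.Nat.DivMod using (_/_; m*n/n≡m)
open import Data.Nat.Combinatorics using (_C_; nCk+nC[k+1]≡[n+1]C[k+1]; k>n⇒nCk≡0; nC1≡n)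
open import Data.Nat.Tactic.RingSolver using (solve-∀)
open import Data.Nat.ListAction using (sum)
open import Data.Bool using (true; if_then_else_)
open import Data.List using (List; []; _∷_; length; applyUpTo; upTo; _++_; replicate; map) renaming (tabulate to tabulateᴸ)
open import Data.List.Properties
  using (length-applyUpTo; length-tabulate; length-++; length-replicate; ++-assoc; ++-identityʳ; ∷-injectiveˡ; ∷-injectiveʳ)
open import Data.List.Relation.Unary.All using (All; []; _∷_)
import Data.List.Relation.Unary.All as All
open import Data.List.Relation.Unary.All.Properties using (tabulate⁺; ++⁺; replicate⁺)
open import Data.List.Relation.Unary.AllPairs using (AllPairs; []; _∷_)
import Data.List.Relation.Unary.AllPairs as AllPairs
open import Data.List.Relation.Unary.AllPairs.Properties using () renaming (++⁺ to AllPairs-++⁺)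
open import Data.List.Relation.Unary.Any using (here; there)
open import Data.List.Membership.Propositional using (_∈_; _∉_)
open import Data.List.Membership.Propositional.Properties using (∈-++⁺ˡ; ∈-++⁺ʳ; ∈-++⁻)
open import Data.Maybe using (just; nothing)
open import Data.Maybe.Properties using (just-injective)
open import Data.Fin using (Fin; toℕ; fromℕ<; splitAt; join) renaming (zero to fzero; suc to fsuc)
open import Data.Fin.Properties using (toℕ-fromℕ<; toℕ<n; splitAt-join; join-splitAt)
open import Data.Fin.Subset using (Subset; ∣_∣; _⊆_) renaming (_∈_ to _∈ₛ_)
open import Data.Fin.Subset.Properties using (⊆-antisym)
open import Data.Vec using (tabulate)
open import Data.Vec.Properties using (lookup∘tabulate; []=⇒lookup; lookup⇒[]=)
open import Data.Product using (Σ; ∃; _×_; _,_; proj₁; proj₂)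
open import Data.Product.Instances
open import Data.Product.Properties using (,-injective; ,-injectiveʳ)
open import Data.Sum using (_⊎_; inj₁; inj₂; [_,_]′)
open import Data.Empty using (⊥-elim)
open import Relation.Nullary using (¬_; Dec; yes; no; does)
open import Relation.Nullary.Decidable using (dec-true)
open import Relation.Binary using (tri<; tri≈; tri>)
open import Relation.Binary.Structures using (IsDecEquivalence)
open import Relation.Binary.TypeClasses using (_≟_)
open import Relation.Binary.PropositionalEquality
open ≡-Reasoning

absorption : ∀ M j → suc j * (suc M C suc j) ≡ suc M * (M C j)
absorption zero zero = refl
absorption zero (suc j) = begin
  suc (suc j) * (1 C suc (suc j)) ≡⟨ cong (suc (suc j) *_) (k>n⇒nCk≡0 {1} {suc (suc j)} (s≤s (s≤s z≤n))) ⟩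
  suc (suc j) * 0                 ≡⟨ *-zeroʳ (suc (suc j)) ⟩
  0                               ≡⟨ sym (cong (_+ 0) (k>n⇒nCk≡0 {0} {suc j} (s≤s z≤n))) ⟩
  1 * (0 C suc j)                 ∎
absorption (suc M) zero = trans (+-identityʳ _) (trans (nC1≡n (suc (suc M))) (sym (*-identityʳ _)))
absorption (suc M) (suc j) = begin
  suc (suc j) * (suc (suc M) C suc (suc j)) ≡⟨ cong (suc (suc j) *_) (sym (nCk+nC[k+1]≡[n+1]C[k+1] (suc M) (suc j))) ⟩
  suc (suc j) * (a + b)                     ≡⟨ split j a b ⟩
  suc j * a + a + suc (suc j) * b           ≡⟨ cong₂ (λ x y → x + a + y) (absorption M j) (absorption M (suc j)) ⟩
  suc M * c + a + suc M * d                 ≡⟨ merge M c d a ⟩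
  suc M * (c + d) + a                       ≡⟨ cong (λ z → suc M * z + a) (nCk+nC[k+1]≡[n+1]C[k+1] M j) ⟩
  suc M * a + a                             ≡⟨ +-comm (suc M * a) a ⟩
  suc (suc M) * a                           ∎
  where
  a = suc M C suc j
  b = suc M C suc (suc j)
  c = M C j
  d = M C suc j
  split : ∀ j a b → suc (suc j) * (a + b) ≡ suc j * a + a + suc (suc j) * b
  split = solve-∀
  merge : ∀ M c d a → suc M * c + a + suc M * d ≡ suc M * (c + d) + a
  merge = solve-∀

-- Fix k = k' + 1.  ballot t h counts the ways to finish reading a tableau when
-- t top cells are still unread and h bottom integers are currently free to be
-- read: either read a free bottom integer, or read the next top cell, which
-- frees the k - 1 bottom integers below it (recursion on (t, h) lexicographically).
module Ballot (k' : ℕ) where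

  k : ℕ
  k = suc k'

  ballot : ℕ → ℕ → ℕ
  ballot zero    h       = 1
  ballot (suc t) zero    = ballot t k'
  ballot (suc t) (suc h) = ballot (suc t) h + ballot t (suc h + k')

  Closed : ℕ → ℕ → Set
  Closed t h = ballot t h * (k * t + suc h) ≡ suc h * ((k * t + suc h) C t)

  -- Closed form when no bottom integer is free: reduces to the case (t, k − 1)
  -- via absorption, with K = k(t+1).
  closed-top : ∀ t → Closed t k' → Closed (suc t) 0
  closed-top t IH = begin
    q * (K + 1)             ≡⟨ cong (q *_) (+-comm K 1) ⟩
    q * suc K               ≡⟨ *-cancelˡ-≡ _ _ K scaled ⟩
    suc K C suc t           ≡⟨ cong (_C suc t) (+-comm 1 K) ⟩
    (K + 1) C suc t         ≡⟨ sym (*-identityˡ _) ⟩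
    1 * ((K + 1) C suc t)   ∎
    where
    q = ballot t k'
    K = k * suc t
    size : k * t + suc k' ≡ K
    size = trans (+-comm (k * t) k) (sym (*-suc k t))
    IH′ : q * K ≡ k * (K C t)
    IH′ = subst (λ z → q * z ≡ k * (z C t)) size IH
    scaled : K * (q * suc K) ≡ K * (suc K C suc t)
    scaled = begin
      K * (q * suc K)                ≡⟨ swap K q ⟩
      suc K * (q * K)                ≡⟨ cong (suc K *_) IH′ ⟩
      suc K * (k * (K C t))          ≡⟨ swap′ K k (K C t) ⟩
      k * (suc K * (K C t))          ≡⟨ cong (k *_) (sym (absorption K t)) ⟩
      k * (suc t * (suc K C suc t))  ≡⟨ sym (*-assoc k (suc t) _) ⟩
      K * (suc K C suc t)            ∎
      where
      swap : ∀ K q → K * (q * suc K) ≡ suc K * (q * K)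
      swap = solve-∀
      swap′ : ∀ K a b → suc K * (a * b) ≡ a * (suc K * b)
      swap′ = solve-∀

  -- The arithmetic heart of the general step, with X = k(t+1) + h + 1,
  -- A = C(X, t+1), B = C(X, t), using (t+1)(A + B) = (X+1)B:
  -- (X+1)((h+1)A + (h+k+1)B) = X(h+2)(A+B).
  step-identity : ∀ t h A B → let X = k * suc t + suc h in
    suc t * A + suc t * B ≡ suc X * B →
    suc X * (suc h * A) + suc X * (suc (suc h + k') * B) ≡ X * (suc (suc h) * (B + A))
  step-identity t h A B absorb = +-cancelʳ-≡ (k * (suc X * B)) _ _ (begin
    L + k * (suc X * B)                      ≡⟨ cong (λ z → L + k * z) (sym absorb) ⟩
    L + k * (suc t * A + suc t * B)          ≡⟨ poly k' t h A B ⟩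
    X * (suc (suc h) * (B + A)) + k * (suc X * B) ∎)
    where
    X = k * suc t + suc h
    L = suc X * (suc h * A) + suc X * (suc (suc h + k') * B)
    poly : ∀ k' t h A B → let X = suc k' * suc t + suc h in
      (suc X * (suc h * A) + suc X * (suc (suc h + k') * B)) + suc k' * (suc t * A + suc t * B)
      ≡ X * (suc (suc h) * (B + A)) + suc k' * (suc X * B)
    poly = solve-∀

  -- General step: Pascal's rule combines the two recursive calls.
  closed-step : ∀ t h → Closed (suc t) h → Closed t (suc h + k') → Closed (suc t) (suc h)
  closed-step t h IH₁ IH₂ = begin
    (q₁ + q₂) * (k * suc t + suc (suc h))  ≡⟨ cong ((q₁ + q₂) *_) (+-suc (k * suc t) (suc h)) ⟩
    (q₁ + q₂) * suc X                      ≡⟨ *-cancelˡ-≡ _ _ X scaled ⟩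
    suc (suc h) * (suc X C suc t)          ≡⟨ cong (λ z → suc (suc h) * (z C suc t)) (sym (+-suc (k * suc t) (suc h))) ⟩
    suc (suc h) * ((k * suc t + suc (suc h)) C suc t) ∎
    where
    X = k * suc t + suc h
    q₁ = ballot (suc t) h
    q₂ = ballot t (suc h + k')
    A = X C suc t
    B = X C t
    size : k * t + suc (suc h + k') ≡ X
    size = solve-size k' t h
      where
      solve-size : ∀ k' t h → suc k' * t + suc (suc h + k') ≡ suc k' * suc t + suc h
      solve-size = solve-∀
    IH₂′ : q₂ * X ≡ suc (suc h + k') * B
    IH₂′ = subst (λ z → q₂ * z ≡ suc (suc h + k') * (z C t)) size IH₂
    absorb : suc t * A + suc t * B ≡ suc X * B
    absorb = begin
      suc t * A + suc t * B   ≡⟨ sym (*-distribˡ-+ (suc t) A B) ⟩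
      suc t * (A + B)         ≡⟨ cong (suc t *_) (+-comm A B) ⟩
      suc t * (B + A)         ≡⟨ cong (suc t *_) (nCk+nC[k+1]≡[n+1]C[k+1] X t) ⟩
      suc t * (suc X C suc t) ≡⟨ absorption X t ⟩
      suc X * B               ∎
    scaled : X * ((q₁ + q₂) * suc X) ≡ X * (suc (suc h) * (suc X C suc t))
    scaled = begin
      X * ((q₁ + q₂) * suc X)                        ≡⟨ expand X q₁ q₂ ⟩
      suc X * (q₁ * X) + suc X * (q₂ * X)            ≡⟨ cong₂ (λ a b → suc X * a + suc X * b) IH₁ IH₂′ ⟩
      suc X * (suc h * A) + suc X * (suc (suc h + k') * B) ≡⟨ step-identity t h A B absorb ⟩
      X * (suc (suc h) * (B + A))                    ≡⟨ cong (λ z → X * (suc (suc h) * z)) (nCk+nC[k+1]≡[n+1]C[k+1] X t) ⟩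
      X * (suc (suc h) * (suc X C suc t))            ∎
      where
      expand : ∀ X a b → X * ((a + b) * suc X) ≡ suc X * (a * X) + suc X * (b * X)
      expand = solve-∀

  -- The closed form, i.e. ballot t h is the Raney number R_{k,h+1}(t).
  ballot-closed : ∀ t h → Closed t h
  ballot-closed zero    h       = trans (cong (1 *_) (cong (_+ suc h) (*-zeroʳ k))) (*-comm 1 (suc h))
  ballot-closed (suc t) zero    = closed-top t (ballot-closed t k')
  ballot-closed (suc t) (suc h) = closed-step t h (ballot-closed (suc t) h) (ballot-closed t (suc h + k'))

  raney≡ballot : ∀ r' n → raney k (suc r') n (s≤s z≤n) ≡ ballot n r'
  raney≡ballot r' n = begin
    (suc r' * (D C n)) / D   ≡⟨ cong (_/ D) (sym (ballot-closed n r')) ⟩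
    (ballot n r' * D) / D    ≡⟨ m*n/n≡m (ballot n r') D ⟩
    ballot n r'              ∎
    where
    D = k * n + suc r'
    instance
      D≢0 : NonZero D
      D≢0 = >-nonZero (≤-trans (s≤s z≤n) (m≤n+m (suc r') (k * n)))

occ : {A : Set} {{_ : IsDecEquivalence {A = A} _≡_}} → A → List A → ℕ
occ a []      = 0
occ a (b ∷ L) = (if does (b ≟ a) then suc else λ m → m) (occ a L)

does-true : {P : Set} (p? : Dec P) → does p? ≡ true → P
does-true (yes p) _ = p

module _ {A : Set} {{_ : IsDecEquivalence {A = A} _≡_}} where

  occ-here : ∀ (a : A) L → occ a (a ∷ L) ≡ suc (occ a L)
  occ-here a L rewrite dec-true (a ≟ a) refl = refl

  occ-skip : ∀ {a : A} (b : A) L → b ≢ a → occ a (b ∷ L) ≡ occ a L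
  occ-skip {a} b L b≢a with b ≟ a
  ... | yes b≡a = ⊥-elim (b≢a b≡a)
  ... | no _    = refl

  occ≢0⇒∈ : ∀ (a : A) L → occ a L ≢ 0 → a ∈ L
  occ≢0⇒∈ a []      ne = ⊥-elim (ne refl)
  occ≢0⇒∈ a (b ∷ L) ne with b ≟ a
  ... | yes b≡a = here (sym b≡a)
  ... | no _    = there (occ≢0⇒∈ a L ne)

  ∈⇒occ≢0 : ∀ {a : A} {L} → a ∈ L → occ a L ≢ 0
  ∈⇒occ≢0 {a} {_ ∷ L} (here refl) = λ e → 1+n≢0 (trans (sym (occ-here a L)) e)
  ∈⇒occ≢0 {a} {b ∷ L} (there a∈L) with b ≟ a
  ... | yes _ = λ ()
  ... | no _  = ∈⇒occ≢0 a∈L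

  ∉⇒occ≡0 : ∀ (a : A) L → a ∉ L → occ a L ≡ 0
  ∉⇒occ≡0 a L a∉L with occ a L ≟ 0
  ... | yes e = e
  ... | no ne = ⊥-elim (a∉L (occ≢0⇒∈ a L ne))

  occ-++ : ∀ (a : A) xs ys → occ a (xs ++ ys) ≡ occ a xs + occ a ys
  occ-++ a []       ys = refl
  occ-++ a (b ∷ xs) ys with b ≟ a
  ... | yes _ = cong suc (occ-++ a xs ys)
  ... | no _  = occ-++ a xs ys

  occ-replicate : ∀ c (a : A) → occ a (replicate c a) ≡ c
  occ-replicate zero    a = refl
  occ-replicate (suc c) a = trans (occ-here a (replicate c a)) (cong suc (occ-replicate c a))

Sorted : List ℕ → Set
Sorted = AllPairs _≤_

sorted-replicate : ∀ c (a : ℕ) → Sorted (replicate c a)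
sorted-replicate zero    a = []
sorted-replicate (suc c) a = replicate⁺ c ≤-refl ∷ sorted-replicate c a

∈-replicate⁻ : ∀ {A : Set} {c} {m a : A} → m ∈ replicate c a → m ≡ a
∈-replicate⁻ {c = c} {a = a} m∈ = All.lookup (replicate⁺ {P = _≡ a} c refl) m∈

∈-replicate⇒1≤ : ∀ {A : Set} {c} {m a : A} → m ∈ replicate c a → 1 ≤ c
∈-replicate⇒1≤ {c = suc c} _ = s≤s z≤n

∈-replicate⁺ : ∀ {A : Set} {c} (a : A) → 1 ≤ c → a ∈ replicate c a
∈-replicate⁺ {c = suc c} a _ = here refl

lookupL-applyUpTo⁻ : ∀ {A : Set} m (f : ℕ → A) j {S} → lookupL (applyUpTo f m) j ≡ just S → j < m × f j ≡ S
lookupL-applyUpTo⁻ (suc m) f zero    e = s≤s z≤n , just-injective e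
lookupL-applyUpTo⁻ (suc m) f (suc j) e with lookupL-applyUpTo⁻ m (λ x → f (suc x)) j e
... | j<m , fj≡S = s≤s j<m , fj≡S

lookupL-applyUpTo : ∀ {A : Set} m (f : ℕ → A) j → j < m → lookupL (applyUpTo f m) j ≡ just (f j)
lookupL-applyUpTo (suc m) f zero    _         = refl
lookupL-applyUpTo (suc m) f (suc j) (s≤s j<m) = lookupL-applyUpTo m (λ x → f (suc x)) j j<m

lookupL-just⇒< : ∀ {A : Set} (xs : List A) j {S} → lookupL xs j ≡ just S → j < length xs
lookupL-just⇒< (x ∷ xs) zero    e = s≤s z≤n
lookupL-just⇒< (x ∷ xs) (suc j) e = s≤s (lookupL-just⇒< xs j e)

lookupL-<⇒just : ∀ {A : Set} (xs : List A) j → j < length xs → ∃ λ S → lookupL xs j ≡ just S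
lookupL-<⇒just (x ∷ xs) zero    _         = x , refl
lookupL-<⇒just (x ∷ xs) (suc j) (s≤s j<l) = lookupL-<⇒just xs j j<l

lookupL-≥⇒nothing : ∀ {A : Set} (xs : List A) j → length xs ≤ j → lookupL xs j ≡ nothing
lookupL-≥⇒nothing []       j       _         = refl
lookupL-≥⇒nothing (x ∷ xs) (suc j) (s≤s l≤j) = lookupL-≥⇒nothing xs j l≤j

lookupL-ext : ∀ {A : Set} (xs ys : List A) → (∀ j → lookupL xs j ≡ lookupL ys j) → xs ≡ ys
lookupL-ext []       []       e = refl
lookupL-ext []       (y ∷ ys) e with e 0
... | ()
lookupL-ext (x ∷ xs) []       e with e 0
... | ()
lookupL-ext (x ∷ xs) (y ∷ ys) e = cong₂ _∷_ (just-injective (e 0)) (lookupL-ext xs ys (λ j → e (suc j)))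

Cell : Set
Cell = ℕ × ℕ

-- c ⋖ d: c and d are adjacent cells, so the entries of c are smaller than those of d.
data _⋖_ : Cell → Cell → Set where
  right : ∀ i j → (i , j) ⋖ (i , suc j)
  down  : ∀ j → (0 , j) ⋖ (1 , j)

⋖-irrefl : ∀ {c} → ¬ c ⋖ c
⋖-irrefl ()

InShape : ℕ → Cell → Set
InShape n (i , j) = i ≤ 1 × j ≤ n

-- A word lists, for each integer 1, 2, …, N in turn, the cell containing it.
-- It respects the tableau order when no letter is followed by a cell that
-- must precede it.
Respects : List Cell → Set
Respects = AllPairs (λ c d → ¬ d ⋖ c)

-- The a-th letter of a word (a dummy cell outside the shape past its end).
letter : List Cell → ℕ → Cell
letter []      _       = (2 , 0)
letter (c ∷ L) zero    = c
letter (c ∷ L) (suc a) = letter L a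

letter-All : ∀ {P : Cell → Set} {L} → All P L → ∀ a → a < length L → P (letter L a)
letter-All (p ∷ ps) zero    _         = p
letter-All (p ∷ ps) (suc a) (s≤s a<l) = letter-All ps a a<l

letter-AllPairs : ∀ {R : Cell → Cell → Set} {L} → AllPairs R L →
                  ∀ a b → a < b → b < length L → R (letter L a) (letter L b)
letter-AllPairs (r ∷ rs) zero    (suc b) _         (s≤s b<l) = letter-All r b b<l
letter-AllPairs (r ∷ rs) (suc a) (suc b) (s≤s a<b) (s≤s b<l) = letter-AllPairs rs a b a<b b<l

letter-ext : ∀ L L′ → length L ≡ length L′ → (∀ a → a < length L → letter L a ≡ letter L′ a) → L ≡ L′
letter-ext []      []        _ _ = refl
letter-ext (c ∷ L) (c′ ∷ L′) e h =
  cong₂ _∷_ (h 0 (s≤s z≤n)) (letter-ext L L′ (suc-injective e) (λ a a<l → h (suc a) (s≤s a<l)))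

letter-tabulate : ∀ {M} (f : Fin M → Cell) (x : Fin M) → letter (tabulateᴸ f) (toℕ x) ≡ f x
letter-tabulate f fzero    = refl
letter-tabulate f (fsuc x) = letter-tabulate (λ y → f (fsuc y)) x

AllPairs-tabulate : ∀ {M} {R : Cell → Cell → Set} (f : Fin M → Cell) →
                    (∀ x y → toℕ x < toℕ y → R (f x) (f y)) → AllPairs R (tabulateᴸ f)
AllPairs-tabulate {zero}  f h = []
AllPairs-tabulate {suc M} f h =
  tabulate⁺ (λ y → h fzero (fsuc y) (s≤s z≤n)) ∷ AllPairs-tabulate (λ y → f (fsuc y)) (λ x y lt → h (fsuc x) (fsuc y) (s≤s lt))

positions : ∀ {M} → List Cell → Cell → Subset M
positions L c = tabulate (λ x → does (letter L (toℕ x) ≟ c))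

∣positions∣ : ∀ M L c → length L ≡ M → ∣ positions {M} L c ∣ ≡ occ c L
∣positions∣ zero    []      c e = refl
∣positions∣ (suc M) (d ∷ L) c e with d ≟ c
... | yes _ = cong suc (∣positions∣ M L c (suc-injective e))
... | no _  = ∣positions∣ M L c (suc-injective e)

∈positions⇒ : ∀ {M} L c (x : Fin M) → x ∈ₛ positions L c → letter L (toℕ x) ≡ c
∈positions⇒ L c x x∈ =
  does-true (letter L (toℕ x) ≟ c) (trans (sym (lookup∘tabulate _ x)) ([]=⇒lookup x∈))

⇒∈positions : ∀ {M} L c (x : Fin M) → letter L (toℕ x) ≡ c → x ∈ₛ positions L c
⇒∈positions L c x e = lookup⇒[]= x _ (trans (lookup∘tabulate _ x) (dec-true (letter L (toℕ x) ≟ c) e))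

module TwoRow (n : ℕ) (ρ : Density) where

  N : ℕ
  N = total (square2 n) ρ

  filling : List Cell → Filling N
  filling L = applyUpTo (λ j → positions L (0 , j)) (suc n)
            ∷ applyUpTo (λ j → positions L (1 , j)) (suc n) ∷ []

  record ReadingWord (L : List Cell) : Set where
    field
      length≡N : length L ≡ N
      inShape  : All (InShape n) L
      occ≡ρ    : ∀ i j → i ≤ 1 → j ≤ n → occ (i , j) L ≡ ρ i j
      respects : Respects L

  in-filling⇒ : ∀ L x i j → In (filling L) x i j → letter L (toℕ x) ≡ (i , j)
  in-filling⇒ L x zero j (S , e , x∈S) with lookupL-applyUpTo⁻ (suc n) (λ j → positions L (0 , j)) j e
  ... | _ , refl = ∈positions⇒ L (0 , j) x x∈S
  in-filling⇒ L x (suc zero) j (S , e , x∈S) with lookupL-applyUpTo⁻ (suc n) (λ j → positions L (1 , j)) j e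
  ... | _ , refl = ∈positions⇒ L (1 , j) x x∈S
  in-filling⇒ L x (suc (suc i)) j (S , () , _)

  ⇒in-filling : ∀ L (x : Fin N) i j → InShape n (i , j) → letter L (toℕ x) ≡ (i , j) → In (filling L) x i j
  ⇒in-filling L x zero j (_ , j≤n) e =
    positions L (0 , j) , lookupL-applyUpTo (suc n) (λ j → positions L (0 , j)) j (s≤s j≤n) , ⇒∈positions L (0 , j) x e
  ⇒in-filling L x (suc zero) j (_ , j≤n) e =
    positions L (1 , j) , lookupL-applyUpTo (suc n) (λ j → positions L (1 , j)) j (s≤s j≤n) , ⇒∈positions L (1 , j) x e
  ⇒in-filling L x (suc (suc i)) j (s≤s () , _) e

  module _ {L : List Cell} (w : ReadingWord L) where
    open ReadingWord w

    <length : ∀ (x : Fin N) → toℕ x < length L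
    <length x = subst (toℕ x <_) (sym length≡N) (toℕ<n x)

    filling-density : ∀ i j S → entry (filling L) i j ≡ just S → ∣ S ∣ ≡ ρ i j
    filling-density zero j S e with lookupL-applyUpTo⁻ (suc n) (λ j → positions L (0 , j)) j e
    ... | s≤s j≤n , refl = trans (∣positions∣ N L (0 , j) length≡N) (occ≡ρ 0 j z≤n j≤n)
    filling-density (suc zero) j S e with lookupL-applyUpTo⁻ (suc n) (λ j → positions L (1 , j)) j e
    ... | s≤s j≤n , refl = trans (∣positions∣ N L (1 , j) length≡N) (occ≡ρ 1 j (s≤s z≤n) j≤n)

    filling-covers : ∀ x → ∃ λ i → ∃ λ j → In (filling L) x i j
    filling-covers x with letter L (toℕ x) in e | letter-All inShape (toℕ x) (<length x)
    ... | (i , j) | inS = i , j , ⇒in-filling L x i j inS e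

    ordered : ∀ (x y : Fin N) {c d} → letter L (toℕ x) ≡ c → letter L (toℕ y) ≡ d → c ⋖ d → toℕ x < toℕ y
    ordered x y ex ey c⋖d with <-cmp (toℕ x) (toℕ y)
    ... | tri< x<y _ _ = x<y
    ... | tri≈ _ x≡y _ =
      ⊥-elim (⋖-irrefl (subst (_⋖ _) (trans (sym ex) (trans (cong (letter L) x≡y) ey)) c⋖d))
    ... | tri> _ _ y<x = ⊥-elim (letter-AllPairs respects (toℕ y) (toℕ x) y<x (<length x) (subst₂ _⋖_ (sym ex) (sym ey) c⋖d))

    filling-colIncr : ∀ x y i j → In (filling L) x i j → In (filling L) y (suc i) j → toℕ x < toℕ y
    filling-colIncr x y zero j x∈ y∈ = ordered x y (in-filling⇒ L x 0 j x∈) (in-filling⇒ L y 1 j y∈) (down j)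
    filling-colIncr x y (suc i) j x∈ (_ , () , _)

    filling-isSVT : IsSVT (square2 n) ρ (filling L)
    filling-isSVT = record
      { shape    = cong₂ (λ a b → a ∷ b ∷ []) (length-applyUpTo (λ j → positions L (0 , j)) (suc n)) (length-applyUpTo (λ j → positions L (1 , j)) (suc n))
      ; density  = filling-density
      ; covering = filling-covers
      ; disjoint = λ x i j i′ j′ p q → ,-injective (trans (sym (in-filling⇒ L x i j p)) (in-filling⇒ L x i′ j′ q))
      ; rowIncr  = λ x y i j p q → ordered x y (in-filling⇒ L x i j p) (in-filling⇒ L y i (suc j) q) (right i j)
      ; colIncr  = filling-colIncr
      }

  -- A reading word is determined by its filling: each letter is recovered as
  -- the cell containing the corresponding integer.
  filling-injective : ∀ {L L′} → ReadingWord L → ReadingWord L′ → filling L ≡ filling L′ → L ≡ L′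
  filling-injective {L} {L′} w w′ eq =
    letter-ext L L′ (trans (ReadingWord.length≡N w) (sym (ReadingWord.length≡N w′))) same-letter
    where
    same-letter : ∀ a → a < length L → letter L a ≡ letter L′ a
    same-letter a a<l with letter L a in e | letter-All (ReadingWord.inShape w) a a<l
    ... | (i , j) | inS =
      let a<N = subst (a <_) (ReadingWord.length≡N w) a<l
          x   = fromℕ< a<N
          x∈  = subst (λ T → In T x i j) eq (⇒in-filling L x i j inS (trans (cong (letter L) (toℕ-fromℕ< a<N)) e))
      in trans (sym (in-filling⇒ L′ x i j x∈)) (cong (letter L′) (toℕ-fromℕ< a<N))

  module WordOf (r₀ r₁ : List (Subset N)) (svt : IsSVT (square2 n) ρ (r₀ ∷ r₁ ∷ [])) where
    open IsSVT svt

    T : Filling N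
    T = r₀ ∷ r₁ ∷ []

    length₀ : length r₀ ≡ suc n
    length₀ = cong (λ { (a ∷ _) → a ; [] → 0 }) shape

    length₁ : length r₁ ≡ suc n
    length₁ = cong (λ { (_ ∷ b ∷ _) → b ; _ → 0 }) shape

    cellOf : Fin N → Cell
    cellOf x = proj₁ (covering x) , proj₁ (proj₂ (covering x))

    in-cellOf : ∀ x → In T x (proj₁ (cellOf x)) (proj₂ (cellOf x))
    in-cellOf x = proj₂ (proj₂ (covering x))

    word : List Cell
    word = tabulateᴸ cellOf

    in-shape : ∀ x i j → In T x i j → InShape n (i , j)
    in-shape x zero       j (S , e , _) = z≤n , s≤s⁻¹ (subst (j <_) length₀ (lookupL-just⇒< r₀ j e))
    in-shape x (suc zero) j (S , e , _) = ≤-refl , s≤s⁻¹ (subst (j <_) length₁ (lookupL-just⇒< r₁ j e))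

    entry≡positions : ∀ i j A → entry T i j ≡ just A → A ≡ positions word (i , j)
    entry≡positions i j A e = ⊆-antisym A⊆ ⊆A
      where
      A⊆ : A ⊆ positions word (i , j)
      A⊆ {x} x∈A with disjoint x i j (proj₁ (cellOf x)) (proj₂ (cellOf x)) (A , e , x∈A) (in-cellOf x)
      ... | i≡ , j≡ = ⇒∈positions word (i , j) x (trans (letter-tabulate cellOf x) (sym (cong₂ _,_ i≡ j≡)))
      ⊆A : positions word (i , j) ⊆ A
      ⊆A {x} x∈ = from-cell (trans (sym (letter-tabulate cellOf x)) (∈positions⇒ word (i , j) x x∈)) (in-cellOf x)
        where
        from-cell : ∀ {c} → c ≡ (i , j) → In T x (proj₁ c) (proj₂ c) → x ∈ₛ A
        from-cell refl (S , e′ , x∈S) = subst (x ∈ₛ_) (just-injective (trans (sym e′) e)) x∈S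

    row≡ : ∀ i (r : List (Subset N)) → length r ≡ suc n →
           (∀ j A → lookupL r j ≡ just A → A ≡ positions word (i , j)) →
           applyUpTo (λ j → positions word (i , j)) (suc n) ≡ r
    row≡ i r len h = lookupL-ext _ r same-entry
      where
      f : ℕ → Subset N
      f j = positions word (i , j)
      same-entry : ∀ j → lookupL (applyUpTo f (suc n)) j ≡ lookupL r j
      same-entry j with j <? suc n
      ... | yes j<n with lookupL-<⇒just r j (subst (j <_) (sym len) j<n)
      ...   | (A , e) = trans (lookupL-applyUpTo (suc n) f j j<n) (trans (cong just (sym (h j A e))) (sym e))
      same-entry j | no j≮n =
        trans (lookupL-≥⇒nothing (applyUpTo f (suc n)) j (subst (_≤ j) (sym (length-applyUpTo f (suc n))) (≮⇒≥ j≮n)))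
              (sym (lookupL-≥⇒nothing r j (subst (_≤ j) (sym len) (≮⇒≥ j≮n))))

    filling-word : filling word ≡ T
    filling-word = cong₂ (λ a b → a ∷ b ∷ [])
      (row≡ 0 r₀ length₀ (entry≡positions 0)) (row≡ 1 r₁ length₁ (entry≡positions 1))

    respects-order : ∀ x y i j i′ j′ → In T x i j → In T y i′ j′ → toℕ x < toℕ y → ¬ (i′ , j′) ⋖ (i , j)
    respects-order x y i j .i j′ x∈ y∈ x<y (right .i .j′) = <-asym x<y (rowIncr y x i j′ y∈ x∈)
    respects-order x y .1 j .0 .j x∈ y∈ x<y (down .j)     = <-asym x<y (colIncr y x 0 j y∈ x∈)

    occ-entry : ∀ i j → (∃ λ A → entry T i j ≡ just A) → occ (i , j) word ≡ ρ i j
    occ-entry i j (A , e) = begin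
      occ (i , j) word                ≡⟨ sym (∣positions∣ N word (i , j) (length-tabulate cellOf)) ⟩
      ∣ positions {N} word (i , j) ∣  ≡⟨ cong ∣_∣ (sym (entry≡positions i j A e)) ⟩
      ∣ A ∣                           ≡⟨ density i j A e ⟩
      ρ i j                           ∎

    occ-word : ∀ i j → i ≤ 1 → j ≤ n → occ (i , j) word ≡ ρ i j
    occ-word zero       j _ j≤n = occ-entry 0 j (lookupL-<⇒just r₀ j (subst (j <_) (sym length₀) (s≤s j≤n)))
    occ-word (suc zero) j _ j≤n = occ-entry 1 j (lookupL-<⇒just r₁ j (subst (j <_) (sym length₁) (s≤s j≤n)))
    occ-word (suc (suc i)) j (s≤s ()) _

    word-isReading : ReadingWord word
    word-isReading = record
      { length≡N = length-tabulate cellOf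
      ; inShape  = tabulate⁺ (λ x → in-shape x _ _ (in-cellOf x))
      ; occ≡ρ    = occ-word
      ; respects = AllPairs-tabulate cellOf (λ x y → respects-order x y _ _ _ _ (in-cellOf x) (in-cellOf y))
      }

  filling-surjective : ∀ T → IsSVT (square2 n) ρ T → Σ (List Cell) λ L → ReadingWord L × filling L ≡ T
  filling-surjective (r₀ ∷ r₁ ∷ []) svt = word , word-isReading , filling-word
    where open WordOf r₀ r₁ svt
  filling-surjective [] svt with IsSVT.shape svt
  ... | ()
  filling-surjective (_ ∷ []) svt with IsSVT.shape svt
  ... | ()
  filling-surjective (_ ∷ _ ∷ _ ∷ _) svt with IsSVT.shape svt
  ... | ()

-- Reading a tableau of shape (n+1)² integer by integer, the state
-- is (p, q): the top cells of columns p, …, n are still unread (the top row is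
-- read left to right), and q is the sorted list of columns of the bottom-row
-- integers still to be read.  A bottom integer of column j can be read only
-- once the top cell of column j has been read (j < p) and the earlier ones of
-- its row have been read, i.e. it is the head of q.
module Completions (n : ℕ) where

  data Completion : ℕ → List ℕ → List Cell → Set where
    done       : Completion (suc n) [] []
    readTop    : ∀ {p q L} → p ≤ n → Completion (suc p) q L → Completion p q ((0 , p) ∷ L)
    readBottom : ∀ {p j q L} → j < p → Completion p q L → Completion p (j ∷ q) ((1 , j) ∷ L)

  data Unread (p : ℕ) (q : List ℕ) : Cell → Set where
    top    : ∀ {j} → p ≤ j → j ≤ n → Unread p q (0 , j)
    bottom : ∀ {j} → j ∈ q → j ≤ n → Unread p q (1 , j)

  completion-p≤ : ∀ {p q L} → Completion p q L → p ≤ suc n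
  completion-p≤ done             = ≤-refl
  completion-p≤ (readTop p≤n _)  = m≤n⇒m≤1+n p≤n
  completion-p≤ (readBottom _ c) = completion-p≤ c

  completion-length : ∀ {p q L} → Completion p q L → length L + p ≡ suc n + length q
  completion-length done = sym (+-identityʳ (suc n))
  completion-length {p} (readTop {L = L} _ c) = trans (sym (+-suc (length L) p)) (completion-length c)
  completion-length (readBottom {q = q} _ c) = trans (cong suc (completion-length c)) (sym (+-suc (suc n) (length q)))

  completion-unread : ∀ {p q L} → Completion p q L → All (Unread p q) L
  completion-unread done = []
  completion-unread (readTop p≤n c) = top ≤-refl p≤n ∷ All.map later (completion-unread c)
    where
    later : ∀ {p q c} → Unread (suc p) q c → Unread p q c
    later (top p<j j≤n)  = top (<⇒≤ p<j) j≤n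
    later (bottom j∈ j≤n) = bottom j∈ j≤n
  completion-unread (readBottom j<p c) =
    bottom (here refl) (s≤s⁻¹ (≤-trans j<p (completion-p≤ c))) ∷ All.map pending (completion-unread c)
    where
    pending : ∀ {p j q c} → Unread p q c → Unread p (j ∷ q) c
    pending (top p≤j j≤n)  = top p≤j j≤n
    pending (bottom j∈ j≤n) = bottom (there j∈) j≤n

  completion-top-read : ∀ {p q L} → Completion p q L → ∀ j → j < p → occ (0 , j) L ≡ 0
  completion-top-read done               j j<p = refl
  completion-top-read (readTop {L = L} _ c) j j<p =
    trans (occ-skip (0 , _) L (λ e → <-irrefl (sym (,-injectiveʳ e)) j<p)) (completion-top-read c j (m<n⇒m<1+n j<p))
  completion-top-read (readBottom {j = j′} {L = L} _ c) j j<p =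
    trans (occ-skip (1 , j′) L (λ ())) (completion-top-read c j j<p)

  completion-top-unread : ∀ {p q L} → Completion p q L → ∀ j → p ≤ j → j ≤ n → occ (0 , j) L ≡ 1
  completion-top-unread done j n<j j≤n = ⊥-elim (<-irrefl refl (≤-trans n<j j≤n))
  completion-top-unread {p} (readTop {L = L} _ c) j p≤j j≤n with p ≟ j
  ... | yes refl = trans (occ-here (0 , p) L) (cong suc (completion-top-read c p (n<1+n p)))
  ... | no p≢j   = trans (occ-skip (0 , p) L (λ e → p≢j (,-injectiveʳ e))) (completion-top-unread c j (≤∧≢⇒< p≤j p≢j) j≤n)
  completion-top-unread (readBottom {j = j′} {L = L} _ c) j p≤j j≤n =
    trans (occ-skip (1 , j′) L (λ ())) (completion-top-unread c j p≤j j≤n)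

  completion-bottom : ∀ {p q L} → Completion p q L → ∀ j → occ (1 , j) L ≡ occ j q
  completion-bottom done j = refl
  completion-bottom (readTop {p} {L = L} _ c) j = trans (occ-skip (0 , p) L (λ ())) (completion-bottom c j)
  completion-bottom (readBottom {j = j′} {q = q} {L = L} _ c) j with j′ ≟ j
  ... | yes refl = trans (occ-here (1 , j′) L) (trans (cong suc (completion-bottom c j′)) (sym (occ-here j′ q)))
  ... | no j′≢j  = trans (occ-skip (1 , j′) L (λ e → j′≢j (,-injectiveʳ e))) (trans (completion-bottom c j) (sym (occ-skip j′ q j′≢j)))

  completion-respects : ∀ {p q L} → Completion p q L → Sorted q → Respects L
  completion-respects done _ = []
  completion-respects {p} (readTop _ c) q↑ = All.map not-before (completion-unread c) ∷ completion-respects c q↑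
    where
    not-before : ∀ {c} → Unread (suc p) _ c → ¬ c ⋖ (0 , p)
    not-before (top p<j _) (right .0 j) = <-irrefl refl (≤-trans (n≤1+n (suc j)) p<j)
    not-before (bottom _ _) ()
  completion-respects (readBottom {j = j} j<p c) (j≤q ∷ q↑) = All.map not-before (completion-unread c) ∷ completion-respects c q↑
    where
    not-before : ∀ {c} → Unread _ _ c → ¬ c ⋖ (1 , j)
    not-before (top p≤j _)    (down .j)     = <-irrefl refl (≤-trans j<p p≤j)
    not-before (bottom j′∈q _) (right .1 j′) = <-irrefl refl (All.lookup j≤q j′∈q)

  completion-start : ∀ {q L} → Completion 0 q L → ∃ λ L′ → L ≡ (0 , 0) ∷ L′ × Completion 1 q L′
  completion-start (readTop _ c) = _ , refl , c

  Contiguous : List ℕ → Set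
  Contiguous q = ∀ {a b m} → a ∈ q → b ∈ q → a ≤ m → m ≤ b → m ∈ q

  contiguous-tail : ∀ {h q} → Sorted (h ∷ q) → Contiguous (h ∷ q) → Contiguous q
  contiguous-tail (h≤q ∷ _) gapless a∈ b∈ a≤m m≤b with gapless (there a∈) (there b∈) a≤m m≤b
  ... | there m∈ = m∈
  ... | here refl = subst (_∈ _) (≤-antisym a≤m (All.lookup h≤q a∈)) a∈

  record Pending (p : ℕ) (q : List ℕ) (L : List Cell) : Set where
    field
      p≤suc-n    : p ≤ suc n
      topRead    : ∀ j → j < p → occ (0 , j) L ≡ 0
      topUnread  : ∀ j → p ≤ j → j ≤ n → occ (0 , j) L ≡ 1
      bottomCount : ∀ j → occ (1 , j) L ≡ occ j q
      inShape    : All (InShape n) L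
      respects   : Respects L
      sorted     : Sorted q
      contiguous : Contiguous q

  blocked : ∀ {c d L} → Respects (d ∷ L) → occ c L ≢ 0 → ¬ c ⋖ d
  blocked {c} {d} {L} (d-first ∷ _) c∈L c⋖d = All.lookup d-first (occ≢0⇒∈ c L c∈L) c⋖d

  pending-end : ∀ {p q} → Pending p q [] → Completion p q []
  pending-end {p} {[]} P with p ≤? n
  ... | yes p≤n = ⊥-elim (0≢1+n (Pending.topUnread P p ≤-refl p≤n))
  ... | no p≰n  = subst (λ p → Completion p [] []) (≤-antisym (≰⇒> p≰n) (Pending.p≤suc-n P)) done
  pending-end {p} {h ∷ q} P = ⊥-elim (∈⇒occ≢0 {L = h ∷ q} (here refl) (sym (Pending.bottomCount P h)))

  pending-top-column : ∀ {p q j L} → Pending p q ((0 , j) ∷ L) → j ≡ p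
  pending-top-column {p} {q} {j} {L} P with p ≤? j
  ... | no p≰j = ⊥-elim (1+n≢0 (trans (sym (occ-here (0 , j) L)) (Pending.topRead P j (≰⇒> p≰j))))
  ... | yes p≤j with p ≟ j
  ...   | yes p≡j = sym p≡j
  ...   | no p≢j with ≤∧≢⇒< p≤j p≢j
  ...     | s≤s {n = j₁} p≤j₁ = ⊥-elim (blocked respects j₁-unread (right 0 j₁))
    where
    open Pending P
    j≤n : suc j₁ ≤ n
    j≤n with inShape
    ... | (_ , j≤n) ∷ _ = j≤n
    j₁-unread : occ (0 , j₁) L ≢ 0
    j₁-unread e = 0≢1+n (begin
      0                                   ≡⟨ sym e ⟩
      occ (0 , j₁) L                      ≡⟨ sym (occ-skip (0 , suc j₁) L (λ e → <-irrefl (sym (,-injectiveʳ e)) (n<1+n j₁))) ⟩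
      occ (0 , j₁) ((0 , suc j₁) ∷ L)     ≡⟨ topUnread j₁ p≤j₁ (≤-trans (n≤1+n j₁) j≤n) ⟩
      1                                   ∎)

  pending-after-top : ∀ {p q L} → Pending p q ((0 , p) ∷ L) → p ≤ n × Pending (suc p) q L
  pending-after-top {p} {q} {L} P = p≤n , record
    { p≤suc-n    = s≤s p≤n
    ; topRead    = topRead′
    ; topUnread  = λ j p<j j≤n → trans (sym (occ-skip (0 , p) L (λ e → <-irrefl (,-injectiveʳ e) p<j))) (topUnread j (<⇒≤ p<j) j≤n)
    ; bottomCount = λ j → trans (sym (occ-skip (0 , p) L (λ ()))) (bottomCount j)
    ; inShape    = All.tail inShape
    ; respects   = AllPairs.tail respects
    ; sorted     = sorted
    ; contiguous = contiguous
    }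
    where
    open Pending P
    p≤n : p ≤ n
    p≤n with inShape
    ... | (_ , p≤n) ∷ _ = p≤n
    topRead′ : ∀ j → j < suc p → occ (0 , j) L ≡ 0
    topRead′ j j<sp with j ≟ p
    ... | yes refl = suc-injective (trans (sym (occ-here (0 , p) L)) (topUnread p ≤-refl p≤n))
    ... | no j≢p   = trans (sym (occ-skip (0 , p) L (λ e → j≢p (sym (,-injectiveʳ e))))) (topRead j (≤∧≢⇒< (s≤s⁻¹ j<sp) j≢p))

  pending-bottom-column : ∀ {p q j L} → Pending p q ((1 , j) ∷ L) → ∃ λ q′ → q ≡ j ∷ q′
  pending-bottom-column {q = []} {j} {L} P =
    ⊥-elim (1+n≢0 (trans (sym (occ-here (1 , j) L)) (Pending.bottomCount P j)))
  pending-bottom-column {p} {h ∷ q} {j} {L} P = q , cong (_∷ q) h≡j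
    where
    open Pending P
    j∈q : j ∈ h ∷ q
    j∈q = occ≢0⇒∈ j (h ∷ q) (λ e → 1+n≢0 (trans (sym (occ-here (1 , j) L)) (trans (bottomCount j) e)))
    h≤j : h ≤ j
    h≤j with j∈q | sorted
    ... | here j≡h  | _       = ≤-reflexive (sym j≡h)
    ... | there j∈  | h≤q ∷ _ = All.lookup h≤q j∈
    h≡j : h ≡ j
    h≡j with h ≟ j
    ... | yes h≡j = h≡j
    ... | no h≢j with ≤∧≢⇒< h≤j h≢j
    ...   | s≤s {n = j₁} h≤j₁ = ⊥-elim (blocked respects j₁-unread (right 1 j₁))
      where
      j₁-unread : occ (1 , j₁) L ≢ 0
      j₁-unread e = ∈⇒occ≢0 (contiguous (here refl) j∈q h≤j₁ (n≤1+n j₁)) (begin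
        occ j₁ (h ∷ q)                    ≡⟨ sym (bottomCount j₁) ⟩
        occ (1 , j₁) ((1 , suc j₁) ∷ L)   ≡⟨ occ-skip (1 , suc j₁) L (λ e → <-irrefl (sym (,-injectiveʳ e)) (n<1+n j₁)) ⟩
        occ (1 , j₁) L                    ≡⟨ e ⟩
        0                                 ∎)

  pending-after-bottom : ∀ {p j q L} → Pending p (j ∷ q) ((1 , j) ∷ L) → j < p × Pending p q L
  pending-after-bottom {p} {j} {q} {L} P = j<p , record
    { p≤suc-n     = p≤suc-n
    ; topRead     = λ j′ j′<p → trans (sym (occ-skip (1 , j) L (λ ()))) (topRead j′ j′<p)
    ; topUnread   = λ j′ p≤j′ j′≤n → trans (sym (occ-skip (1 , j) L (λ ()))) (topUnread j′ p≤j′ j′≤n)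
    ; bottomCount = bottomCount′
    ; inShape     = All.tail inShape
    ; respects    = AllPairs.tail respects
    ; sorted      = AllPairs.tail sorted
    ; contiguous  = contiguous-tail sorted contiguous
    }
    where
    open Pending P
    j<p : j < p
    j<p with p ≤? j | inShape
    ... | no p≰j  | _              = ≰⇒> p≰j
    ... | yes p≤j | (_ , j≤n) ∷ _  = ⊥-elim (blocked respects top-unread (down j))
      where
      top-unread : occ (0 , j) L ≢ 0
      top-unread e = 0≢1+n (trans (sym e) (trans (sym (occ-skip (1 , j) L (λ ()))) (topUnread j p≤j j≤n)))
    bottomCount′ : ∀ j′ → occ (1 , j′) L ≡ occ j′ q
    bottomCount′ j′ with j ≟ j′
    ... | yes refl = suc-injective (trans (sym (occ-here (1 , j) L)) (trans (bottomCount j) (occ-here j q)))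
    ... | no j≢j′  = trans (sym (occ-skip (1 , j) L (λ e → j≢j′ (,-injectiveʳ e)))) (trans (bottomCount j′) (occ-skip j q j≢j′))

  pending⇒completion : ∀ {p q} L → Pending p q L → Completion p q L
  pending⇒completion [] P = pending-end P
  pending⇒completion ((0 , j) ∷ L) P with pending-top-column P
  ... | refl with pending-after-top P
  ...   | p≤n , P′ = readTop p≤n (pending⇒completion L P′)
  pending⇒completion ((1 , j) ∷ L) P with pending-bottom-column P
  ... | q′ , refl with pending-after-bottom P
  ...   | j<p , P′ = readBottom j<p (pending⇒completion L P′)
  pending⇒completion ((suc (suc i) , j) ∷ L) P with Pending.inShape P
  ... | (s≤s () , _) ∷ _

-- Enumerating completions.  With k = k' + 1, reading the top cell of a column
-- j ≥ 1 releases the k' bottom integers of column j.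
module Enumeration (n k' : ℕ) where
  open Ballot k'
  open Completions n

  stair : ℕ → ℕ → List ℕ
  stair a zero    = []
  stair a (suc u) = replicate k' a ++ stair (suc a) u

  stair-≥ : ∀ a u → All (a ≤_) (stair a u)
  stair-≥ a zero    = []
  stair-≥ a (suc u) = ++⁺ (replicate⁺ k' ≤-refl) (All.map (≤-trans (n≤1+n a)) (stair-≥ (suc a) u))

  sorted-stair : ∀ a u → Sorted (stair a u)
  sorted-stair a zero    = []
  sorted-stair a (suc u) = AllPairs-++⁺ (sorted-replicate k' a) (sorted-stair (suc a) u)
    (replicate⁺ k' (All.map (≤-trans (n≤1+n a)) (stair-≥ (suc a) u)))

  ∈-stair⁻ : ∀ {m} a u → m ∈ stair a u → 1 ≤ k' × a ≤ m × m < a + u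
  ∈-stair⁻ {m} a (suc u) m∈ with ∈-++⁻ (replicate k' a) m∈
  ... | inj₁ m∈rep with ∈-replicate⁻ {c = k'} m∈rep
  ...   | refl = ∈-replicate⇒1≤ {c = k'} m∈rep , ≤-refl , subst (m <_) (sym (+-suc m u)) (s≤s (m≤m+n m u))
  ∈-stair⁻ {m} a (suc u) m∈ | inj₂ m∈stair with ∈-stair⁻ (suc a) u m∈stair
  ... | 1≤k' , a<m , m<a+u = 1≤k' , <⇒≤ a<m , subst (m <_) (sym (+-suc a u)) m<a+u

  ∈-stair⁺ : ∀ {m} a u → 1 ≤ k' → a ≤ m → m < a + u → m ∈ stair a u
  ∈-stair⁺ {m} a zero    1≤k' a≤m m<a = ⊥-elim (<-irrefl refl (<-≤-trans m<a (subst (_≤ m) (sym (+-identityʳ a)) a≤m)))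
  ∈-stair⁺ {m} a (suc u) 1≤k' a≤m m<a+u with a ≟ m
  ... | yes refl = ∈-++⁺ˡ (∈-replicate⁺ a 1≤k')
  ... | no a≢m   = ∈-++⁺ʳ (replicate k' a) (∈-stair⁺ (suc a) u 1≤k' (≤∧≢⇒< a≤m a≢m) (subst (m <_) (+-suc a u) m<a+u))

  occ-stair : ∀ a u j → a ≤ j → j < a + u → occ j (stair a u) ≡ k'
  occ-stair a zero    j a≤j j<a = ⊥-elim (<-irrefl refl (<-≤-trans j<a (subst (_≤ j) (sym (+-identityʳ a)) a≤j)))
  occ-stair a (suc u) j a≤j j<a+u with a ≟ j
  ... | yes refl = begin
    occ a (replicate k' a ++ stair (suc a) u)    ≡⟨ occ-++ a (replicate k' a) _ ⟩
    occ a (replicate k' a) + occ a (stair (suc a) u)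
      ≡⟨ cong₂ _+_ (occ-replicate k' a) (∉⇒occ≡0 a _ (λ a∈ → <-irrefl refl (proj₁ (proj₂ (∈-stair⁻ (suc a) u a∈))))) ⟩
    k' + 0                                       ≡⟨ +-identityʳ k' ⟩
    k'                                           ∎
  ... | no a≢j = begin
    occ j (replicate k' a ++ stair (suc a) u)    ≡⟨ occ-++ j (replicate k' a) _ ⟩
    occ j (replicate k' a) + occ j (stair (suc a) u)
      ≡⟨ cong₂ _+_ (∉⇒occ≡0 j _ (λ j∈ → a≢j (sym (∈-replicate⁻ {c = k'} j∈))))
                   (occ-stair (suc a) u j (≤∧≢⇒< a≤j a≢j) (subst (j <_) (+-suc a u) j<a+u)) ⟩
    k'                                           ∎

  length-stair : ∀ a u → length (stair a u) ≡ u * k'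
  length-stair a zero    = refl
  length-stair a (suc u) = trans (length-++ (replicate k' a)) (cong₂ _+_ (length-replicate k') (length-stair (suc a) u))

  -- A state with t unread top cells and h free bottom integers: the queue is
  -- the free integers (all in read columns) followed by those still locked
  -- below the unread top cells.
  record Reachable (t h p : ℕ) (q : List ℕ) : Set where
    field
      free    : List ℕ
      queue   : q ≡ free ++ stair p t
      #free   : length free ≡ h
      free<p  : All (_< p) free
      t+p≡    : t + p ≡ suc n

  reachable-top : ∀ {t h p q} → Reachable (suc t) h p q → p ≤ n × Reachable t (h + k') (suc p) q
  reachable-top {t} {h} {p} {q} R = s≤s⁻¹ (subst (p <_) t+p≡ (s≤s (m≤n+m p t))) , record
    { free   = free ++ replicate k' p
    ; queue  = trans queue (sym (++-assoc free (replicate k' p) (stair (suc p) t)))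
    ; #free  = trans (length-++ free) (cong₂ _+_ #free (length-replicate k'))
    ; free<p = ++⁺ (All.map m<n⇒m<1+n free<p) (replicate⁺ k' (n<1+n p))
    ; t+p≡   = trans (+-suc t p) t+p≡
    }
    where open Reachable R

  reachable-cons : ∀ {t h p q} → Reachable t (suc h) p q → ∃ λ j → ∃ λ q′ → q ≡ j ∷ q′
  reachable-cons R with Reachable.free R | Reachable.queue R | Reachable.#free R
  ... | j ∷ f | refl | _ = j , f ++ _ , refl

  reachable-bottom : ∀ {t h p j q} → Reachable t (suc h) p (j ∷ q) → j < p × Reachable t h p q
  reachable-bottom R with Reachable.free R | Reachable.queue R | Reachable.#free R | Reachable.free<p R
  ... | j ∷ f | refl | #f | j<p ∷ f<p =
    j<p , record { free = f ; queue = refl ; #free = suc-injective #f ; free<p = f<p ; t+p≡ = Reachable.t+p≡ R }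

  reachable-locked : ∀ {t p q} → Reachable t 0 p q → All (p ≤_) q
  reachable-locked {t} {p} R with Reachable.free R | Reachable.queue R | Reachable.#free R
  ... | [] | refl | _ = stair-≥ p t

  reachable-end : ∀ {h p q} → Reachable 0 h p q → p ≡ suc n × All (_< suc n) q
  reachable-end R with Reachable.free R | Reachable.queue R | Reachable.free<p R | Reachable.t+p≡ R
  ... | f | refl | f<p | refl = refl , subst (All _) (sym (++-identityʳ f)) f<p

  -- Head and tail of the queue (with harmless values on the empty queue, which
  -- does not occur in reachable states).
  head₀ : List ℕ → ℕ
  head₀ []      = 0
  head₀ (x ∷ _) = x

  tail₀ : List ℕ → List ℕ
  tail₀ []       = []
  tail₀ (_ ∷ xs) = xs

  -- The i-th completion from a state.  From (t + 1, h + 1) the first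
  -- ballot (t + 1) h indices read the first free bottom integer, the others
  -- read the top cell (0, p).
  enumerate : ∀ t h → ℕ → List ℕ → Fin (ballot t h) → List Cell
  enumerate zero    h       p q _ = map (1 ,_) q
  enumerate (suc t) zero    p q i = (0 , p) ∷ enumerate t k' (suc p) q i
  enumerate (suc t) (suc h) p q i =
    [ (λ a → (1 , head₀ q) ∷ enumerate (suc t) h p (tail₀ q) a)
    , (λ b → (0 , p) ∷ enumerate t (suc h + k') (suc p) q b)
    ]′ (splitAt (ballot (suc t) h) i)

  completion-bottoms : ∀ q → All (_< suc n) q → Completion (suc n) q (map (1 ,_) q)
  completion-bottoms []      _           = done
  completion-bottoms (j ∷ q) (j<n ∷ q<n) = readBottom j<n (completion-bottoms q q<n)

  completion-bottoms⁻ : ∀ {q L} → Completion (suc n) q L → map (1 ,_) q ≡ L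
  completion-bottoms⁻ done             = refl
  completion-bottoms⁻ (readTop n<n _)  = ⊥-elim (<-irrefl refl n<n)
  completion-bottoms⁻ (readBottom _ c) = cong (_ ∷_) (completion-bottoms⁻ c)

  enumerate-completion : ∀ t h p q → Reachable t h p q → ∀ i → Completion p q (enumerate t h p q i)
  enumerate-completion zero h p q R i with reachable-end R
  ... | refl , q<n = completion-bottoms q q<n
  enumerate-completion (suc t) zero p q R i with reachable-top R
  ... | p≤n , R′ = readTop p≤n (enumerate-completion t k' (suc p) q R′ i)
  enumerate-completion (suc t) (suc h) p q R i with splitAt (ballot (suc t) h) i
  ... | inj₂ b with reachable-top R
  ...   | p≤n , R′ = readTop p≤n (enumerate-completion t (suc h + k') (suc p) q R′ b)
  enumerate-completion (suc t) (suc h) p q R i | inj₁ a with reachable-cons R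
  ... | j , q′ , refl with reachable-bottom R
  ...   | j<p , R′ = readBottom j<p (enumerate-completion (suc t) h p q′ R′ a)

  splitAt-injective : ∀ m {m′} (i i′ : Fin (m + m′)) → splitAt m i ≡ splitAt m i′ → i ≡ i′
  splitAt-injective m {m′} i i′ e = begin
    i                        ≡⟨ sym (join-splitAt m m′ i) ⟩
    join m m′ (splitAt m i)  ≡⟨ cong (join m m′) e ⟩
    join m m′ (splitAt m i′) ≡⟨ join-splitAt m m′ i′ ⟩
    i′                       ∎

  join-injective : ∀ m {m′} {c d : Cell} (f : Fin m → List Cell) (g : Fin m′ → List Cell) → c ≢ d →
    (∀ a a′ → f a ≡ f a′ → a ≡ a′) → (∀ b b′ → g b ≡ g b′ → b ≡ b′) →
    ∀ i i′ → [ (λ a → c ∷ f a) , (λ b → d ∷ g b) ]′ (splitAt m i)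
           ≡ [ (λ a → c ∷ f a) , (λ b → d ∷ g b) ]′ (splitAt m i′) → i ≡ i′
  join-injective m f g c≢d f-inj g-inj i i′ e with splitAt m i in split | splitAt m i′ in split′
  ... | inj₁ a | inj₁ a′ = splitAt-injective m i i′ (trans split (trans (cong inj₁ (f-inj a a′ (∷-injectiveʳ e))) (sym split′)))
  ... | inj₂ b | inj₂ b′ = splitAt-injective m i i′ (trans split (trans (cong inj₂ (g-inj b b′ (∷-injectiveʳ e))) (sym split′)))
  ... | inj₁ a | inj₂ b′ = ⊥-elim (c≢d (∷-injectiveˡ e))
  ... | inj₂ b | inj₁ a′ = ⊥-elim (c≢d (sym (∷-injectiveˡ e)))

  enumerate-injective : ∀ t h p q (i i′ : Fin (ballot t h)) → enumerate t h p q i ≡ enumerate t h p q i′ → i ≡ i′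
  enumerate-injective zero    h       p q fzero fzero e = refl
  enumerate-injective (suc t) zero    p q i i′ e = enumerate-injective t k' (suc p) q i i′ (∷-injectiveʳ e)
  enumerate-injective (suc t) (suc h) p q =
    join-injective (ballot (suc t) h) (enumerate (suc t) h p (tail₀ q)) (enumerate t (suc h + k') (suc p) q) (λ ())
      (enumerate-injective (suc t) h p (tail₀ q)) (enumerate-injective t (suc h + k') (suc p) q)

  enumerate-surjective : ∀ t h p q → Reachable t h p q → ∀ {L} → Completion p q L → ∃ λ i → enumerate t h p q i ≡ L
  enumerate-surjective zero h p q R c with reachable-end R
  ... | refl , _ = fzero , completion-bottoms⁻ c
  enumerate-surjective (suc t) h p q R done = ⊥-elim (<-irrefl (sym (Reachable.t+p≡ R)) (s≤s (m≤n+m (suc n) t)))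
  enumerate-surjective (suc t) zero p q R (readTop _ c) with enumerate-surjective t k' (suc p) q (proj₂ (reachable-top R)) c
  ... | i , e = i , cong ((0 , p) ∷_) e
  enumerate-surjective (suc t) zero p (j ∷ q) R (readBottom j<p c) =
    ⊥-elim (<-irrefl refl (<-≤-trans j<p (All.head (reachable-locked R))))
  enumerate-surjective (suc t) (suc h) p q R (readTop _ c) with enumerate-surjective t (suc h + k') (suc p) q (proj₂ (reachable-top R)) c
  ... | b , e = join m m′ (inj₂ b) , trans (cong [ _ , _ ]′ (splitAt-join m m′ (inj₂ b))) (cong ((0 , p) ∷_) e)
    where
    m  = ballot (suc t) h
    m′ = ballot t (suc h + k')
  enumerate-surjective (suc t) (suc h) p (j ∷ q) R (readBottom _ c) with enumerate-surjective (suc t) h p q (proj₂ (reachable-bottom R)) c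
  ... | a , e = join m m′ (inj₁ a) , trans (cong [ _ , _ ]′ (splitAt-join m m′ (inj₁ a))) (cong ((1 , j) ∷_) e)
    where
    m  = ballot (suc t) h
    m′ = ballot t (suc h + k')

  -- The bottom row of ρ(k, r), as a queue: r − 1 integers in column 0 and
  -- k − 1 in each column 1, …, n.
  module Initial (r' : ℕ) where

    q₀ : List ℕ
    q₀ = replicate r' 0 ++ stair 1 n

    q₀-sorted : Sorted q₀
    q₀-sorted = AllPairs-++⁺ (sorted-replicate r' 0) (sorted-stair 1 n)
      (replicate⁺ r' (All.map (λ _ → z≤n) (stair-≥ 1 n)))

    q₀-contiguous : Contiguous q₀
    q₀-contiguous {a} {b} {zero}  a∈ b∈ a≤0 _ = subst (_∈ q₀) (n≤0⇒n≡0 a≤0) a∈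
    q₀-contiguous {a} {b} {suc m} a∈ b∈ _ m<b with ∈-++⁻ (replicate r' 0) b∈
    ... | inj₁ b∈rep = ⊥-elim (<-irrefl refl (<-≤-trans (s≤s z≤n) (subst (suc m ≤_) (∈-replicate⁻ {c = r'} b∈rep) m<b)))
    ... | inj₂ b∈stair with ∈-stair⁻ 1 n b∈stair
    ...   | 1≤k' , _ , b<1+n = ∈-++⁺ʳ (replicate r' 0) (∈-stair⁺ 1 n 1≤k' (s≤s z≤n) (≤-<-trans m<b b<1+n))

    occ-q₀ : ∀ j → j ≤ n → occ j q₀ ≡ ρkr (suc k') (suc r') 1 j
    occ-q₀ zero _ = begin
      occ 0 q₀                                   ≡⟨ occ-++ 0 (replicate r' 0) _ ⟩
      occ 0 (replicate r' 0) + occ 0 (stair 1 n) ≡⟨ cong₂ _+_ (occ-replicate r' 0) (∉⇒occ≡0 0 _ (λ 0∈ → <-irrefl refl (proj₁ (proj₂ (∈-stair⁻ 1 n 0∈))))) ⟩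
      r' + 0                                     ≡⟨ +-identityʳ r' ⟩
      r'                                         ∎
    occ-q₀ (suc j) j<n = begin
      occ (suc j) q₀                                         ≡⟨ occ-++ (suc j) (replicate r' 0) _ ⟩
      occ (suc j) (replicate r' 0) + occ (suc j) (stair 1 n) ≡⟨ cong₂ _+_ (∉⇒occ≡0 (suc j) _ (λ j∈ → 1+n≢0 (∈-replicate⁻ {c = r'} j∈)))
                                                                      (occ-stair 1 n (suc j) (s≤s z≤n) (s≤s j<n)) ⟩
      k'                                                     ∎

    occ-q₀-outside : ∀ j → n < j → occ j q₀ ≡ 0
    occ-q₀-outside j n<j = ∉⇒occ≡0 j q₀ j∉
      where
      j∉ : j ∉ q₀
      j∉ j∈ with ∈-++⁻ (replicate r' 0) j∈
      ... | inj₁ j∈rep   = n≮0 (subst (n <_) (∈-replicate⁻ {c = r'} j∈rep) n<j)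
      ... | inj₂ j∈stair = <-irrefl refl (<-≤-trans n<j (s≤s⁻¹ (proj₂ (proj₂ (∈-stair⁻ 1 n j∈stair)))))

    length-q₀ : length q₀ ≡ r' + n * k'
    length-q₀ = trans (length-++ (replicate r' 0)) (cong₂ _+_ (length-replicate r') (length-stair 1 n))

    -- After reading the top cell of column 0, the r − 1 integers below it are free.
    reachable-q₀ : Reachable n r' 1 q₀
    reachable-q₀ = record
      { free = replicate r' 0 ; queue = refl ; #free = length-replicate r'
      ; free<p = replicate⁺ r' (s≤s z≤n) ; t+p≡ = +-comm n 1 }

module Count (n k' r' : ℕ) where
  ρ : Density
  ρ = ρkr (suc k') (suc r')

  open TwoRow n ρ
  open Completions n
  open Ballot k'
  open Enumeration n k'
  open Initial r'

  sum-top : ∀ xs → sum (map (ρ 0) xs) ≡ length xs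
  sum-top []       = refl
  sum-top (x ∷ xs) = cong suc (sum-top xs)

  sum-bottom : ∀ m (f : ℕ → ℕ) → sum (map (ρ 1) (applyUpTo (λ x → suc (f x)) m)) ≡ m * k'
  sum-bottom zero    f = refl
  sum-bottom (suc m) f = cong (k' +_) (sum-bottom m (λ x → f (suc x)))

  N≡ : N ≡ suc n + length q₀
  N≡ = begin
    N                      ≡⟨ cong₂ _+_ (trans (sum-top (upTo (suc n))) (length-applyUpTo (λ x → x) (suc n)))
                                        (trans (+-identityʳ _) (cong (r' +_) (sum-bottom n (λ x → x)))) ⟩
    suc n + (r' + n * k')  ≡⟨ cong (suc n +_) (sym length-q₀) ⟩
    suc n + length q₀      ∎

  completion⇒reading : ∀ {L} → Completion 0 q₀ L → ReadingWord L
  completion⇒reading {L} c = record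
    { length≡N = trans (sym (+-identityʳ _)) (trans (completion-length c) (sym N≡))
    ; inShape  = All.map in-shape (completion-unread c)
    ; occ≡ρ    = occ-cell
    ; respects = completion-respects c q₀-sorted
    }
    where
    in-shape : ∀ {c} → Unread 0 q₀ c → InShape n c
    in-shape (top _ j≤n)    = z≤n , j≤n
    in-shape (bottom _ j≤n) = s≤s z≤n , j≤n
    occ-cell : ∀ i j → i ≤ 1 → j ≤ n → occ (i , j) L ≡ ρ i j
    occ-cell zero       j _ j≤n = completion-top-unread c j z≤n j≤n
    occ-cell (suc zero) j _ j≤n = trans (completion-bottom c j) (occ-q₀ j j≤n)
    occ-cell (suc (suc i)) j (s≤s ()) _

  reading⇒completion : ∀ {L} → ReadingWord L → Completion 0 q₀ L
  reading⇒completion {L} w = pending⇒completion L (record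
    { p≤suc-n     = z≤n
    ; topRead     = λ j ()
    ; topUnread   = λ j _ j≤n → occ≡ρ 0 j z≤n j≤n
    ; bottomCount = bottomCount
    ; inShape     = inShape
    ; respects    = respects
    ; sorted      = q₀-sorted
    ; contiguous  = q₀-contiguous
    })
    where
    open ReadingWord w
    bottomCount : ∀ j → occ (1 , j) L ≡ occ j q₀
    bottomCount j with j ≤? n
    ... | yes j≤n = trans (occ≡ρ 1 j (s≤s z≤n) j≤n) (sym (occ-q₀ j j≤n))
    ... | no j≰n  = trans (∉⇒occ≡0 (1 , j) L (λ j∈ → j≰n (proj₂ (All.lookup inShape j∈))))
                          (sym (occ-q₀-outside j (≰⇒> j≰n)))

  word : Fin (ballot n r') → List Cell
  word i = (0 , 0) ∷ enumerate n r' 1 q₀ i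

  word-reading : ∀ i → ReadingWord (word i)
  word-reading i = completion⇒reading (readTop z≤n (enumerate-completion n r' 1 q₀ reachable-q₀ i))

  svt-count : CardSVT (square2 n) ρ (ballot n r')
  svt-count = (λ i → filling (word i)) , (λ i → filling-isSVT (word-reading i)) , injective , surjective
    where
    injective : ∀ {i i′} → filling (word i) ≡ filling (word i′) → i ≡ i′
    injective {i} {i′} e = enumerate-injective n r' 1 q₀ i i′
      (∷-injectiveʳ (filling-injective (word-reading i) (word-reading i′) e))
    surjective : ∀ T → IsSVT (square2 n) ρ T → ∃ λ i → filling (word i) ≡ T
    surjective T svt with filling-surjective T svt
    ... | L , w , filling≡T with completion-start (reading⇒completion w)
    ...   | L′ , refl , c with enumerate-surjective n r' 1 q₀ reachable-q₀ c
    ...     | i , e = i , trans (cong (λ L′ → filling ((0 , 0) ∷ L′)) e) filling≡T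

theorem2p2 : (k r n : ℕ) → 1 ≤ k → (hr : 1 ≤ r) →
    CardSVT (square2 n) (ρkr k r) (raney k r n hr)
theorem2p2 (suc k') (suc r') n _ (s≤s z≤n) =
  subst (CardSVT (square2 n) (ρkr (suc k') (suc r'))) (sym (Ballot.raney≡ballot k' r' n)) (Count.svt-count n k' r')
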